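{- Let $G=(V_G,E_G)$ and $H=(V_H,E_H)$ be finite simple graphs. Then the wreath product $G\wr H$ is bipartite if and only if both $G$ and $H$ are bipartite.
   Context: All graphs are finite, undirected and simple. The wreath product $G\wr H$ is the graph with vertex set $\{(f,v): f:V_G\to V_H \text{ a map},\ v\in V_G\}$, in which two vertices $(f,v)$ and $(f',v')$ are adjacent if and only if either (edges of type I) $v=v'$, $f(w)=f'(w)$ for every $w\neq v$, and $f(v)\sim f'(v)$ in $H$; or (edges of type II) $f(w)=f'(w)$ for every $w\in V_G$ and $v\sim v'$ in $G$. -}

module Defs where

open import Level using (Level; _⊔_; suc)
open import Data.Nat using (ℕ)
open import Data.Fin using (Fin)
open import Data.Bool using (Bool)
open import Data.Product using (Σ; _×_; _,_; ∃)
open import Data.Sum using (_⊎_)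
open import Relation.Nullary using (¬_)
open import Relation.Binary.PropositionalEquality using (_≡_; _≢_)

record FinGraph (n : ℕ) : Set₁ where
  field
    Adj   : Fin n → Fin n → Set
    sym   : ∀ {u v} → Adj u v → Adj v u
    irrefl : ∀ {u} → ¬ Adj u u
open FinGraph public

IsBipartite : ∀ {a ℓ} {V : Set a} → (V → V → Set ℓ) → Set (a ⊔ ℓ)
IsBipartite {V = V} Adj = Σ (V → Bool) λ c → ∀ x y → Adj x y → c x ≢ c y

BipartiteGraph : ∀ {n} → FinGraph n → Set
BipartiteGraph G = IsBipartite (Adj G)

WreathVertex : ℕ → ℕ → Set
WreathVertex g h = (Fin g → Fin h) × Fin g

-- Adjacency in G ≀ H (type I or type II edges).
WreathAdj : ∀ {g h} → FinGraph g → FinGraph h →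
            WreathVertex g h → WreathVertex g h → Set
WreathAdj G H (f , v) (f' , v') =
  (v ≡ v' × (∀ w → w ≢ v → f w ≡ f' w) × Adj H (f v) (f' v))
  ⊎ ((∀ w → f w ≡ f' w) × Adj G v v')

module Submission where

-- Colour (f , v) by the colour of v in G plus, mod 2, the number of w with f w
-- on the "true" side of H.  A type II edge changes only the first summand; a
-- type I edge changes exactly one value of f to an adjacent, hence oppositely
-- coloured, vertex of H and so flips the parity.  Conversely G and H sit inside
-- G ≀ H as the copies {(f₀ , v)} and {(f₀[v₀ ↦ x] , v₀)}, and a colouring
-- restricts to them.

open import Defs hiding (sym)
open import Data.Nat using (suc)
open import Data.Fin using (Fin; zero; suc)
open import Data.Fin.Properties using (suc-injective)
open import Data.Bool using (Bool; not; _xor_; false)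
open import Data.Bool.Properties
  using (not-¬; ¬-not; not-distribˡ-xor; not-distribʳ-xor)
open import Data.Product using (_×_; _,_)
open import Data.Sum using (inj₁; inj₂)
open import Data.Vec.Functional using (foldr; updateAt)
open import Data.Vec.Functional.Properties using (updateAt-updates; updateAt-minimal)
open import Function using (_∘_; const)
open import Function.Bundles using (_⇔_; mk⇔)
open import Relation.Binary.PropositionalEquality
  using (_≡_; _≢_; refl; sym; trans; cong; cong₂; subst₂)

parity : ∀ {k} → (Fin k → Bool) → Bool
parity = foldr _xor_ false

parity-cong : ∀ {k} {xs ys : Fin k → Bool} → (∀ w → xs w ≡ ys w) → parity xs ≡ parity ys
parity-cong {0}     _     = refl
parity-cong {suc k} xs≗ys = cong₂ _xor_ (xs≗ys zero) (parity-cong (xs≗ys ∘ suc))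

parity-flip : ∀ {k} {xs ys : Fin k → Bool} (v : Fin k) →
              (∀ w → w ≢ v → xs w ≡ ys w) → xs v ≢ ys v →
              parity ys ≡ not (parity xs)
parity-flip {xs = xs} zero agree xs₀≢ys₀ = trans
  (cong₂ _xor_ (¬-not (xs₀≢ys₀ ∘ sym)) (sym (parity-cong (λ w → agree (suc w) λ ()))))
  (sym (not-distribˡ-xor (xs zero) _))
parity-flip {xs = xs} (suc v) agree xsᵥ≢ysᵥ = trans
  (cong₂ _xor_ (sym (agree zero λ ()))
                (parity-flip v (λ w w≢v → agree (suc w) (w≢v ∘ suc-injective)) xsᵥ≢ysᵥ))
  (sym (not-distribʳ-xor (xs zero) _))

isBipartite-pullback : ∀ {a b ℓ ℓ′} {U : Set a} {V : Set b}
  {A : U → U → Set ℓ} {B : V → V → Set ℓ′} (φ : U → V) →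
  (∀ x y → A x y → B (φ x) (φ y)) → IsBipartite B → IsBipartite A
isBipartite-pullback φ hom (c , proper) = c ∘ φ , λ x y → proper (φ x) (φ y) ∘ hom x y

isBipartite-fromNot : ∀ {a ℓ} {V : Set a} {A : V → V → Set ℓ} (c : V → Bool) →
  (∀ x y → A x y → c y ≡ not (c x)) → IsBipartite A
isBipartite-fromNot c flips = c , λ x y xy cx≡cy → not-¬ refl (trans cx≡cy (flips x y xy))

module _ {g h} (G : FinGraph g) (H : FinGraph h) where

  wreath-base : ∀ (f₀ : Fin g → Fin h) u v → Adj G u v → WreathAdj G H (f₀ , u) (f₀ , v)
  wreath-base f₀ u v uv = inj₂ ((λ _ → refl) , uv)

  wreath-fibre : ∀ (f₀ : Fin g → Fin h) (v : Fin g) x y → Adj H x y →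
    WreathAdj G H (updateAt f₀ v (const x) , v) (updateAt f₀ v (const y) , v)
  wreath-fibre f₀ v x y xy =
    inj₁ (refl , agree , subst₂ (Adj H) (sym (updateAt-updates v f₀)) (sym (updateAt-updates v f₀)) xy)
    where
    agree : ∀ w → w ≢ v → updateAt f₀ v (const x) w ≡ updateAt f₀ v (const y) w
    agree w w≢v = trans (updateAt-minimal w v f₀ w≢v) (sym (updateAt-minimal w v f₀ w≢v))

  wreathColouring : (Fin g → Bool) → (Fin h → Bool) → WreathVertex g h → Bool
  wreathColouring cG cH (f , v) = cG v xor parity (cH ∘ f)

  wreathColouring-flips : ∀ {cG cH} →
    (∀ u v → Adj G u v → cG u ≢ cG v) → (∀ x y → Adj H x y → cH x ≢ cH y) →
    ∀ p q → WreathAdj G H p q → wreathColouring cG cH q ≡ not (wreathColouring cG cH p)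
  wreathColouring-flips {cG} {cH} _ properH (f , v) (f′ , .v) (inj₁ (refl , agree , fv~f′v)) = trans
    (cong (cG v xor_) (parity-flip v (λ w → cong cH ∘ agree w) (properH _ _ fv~f′v)))
    (sym (not-distribʳ-xor (cG v) _))
  wreathColouring-flips {cG} {cH} properG _ (f , u) (f′ , v) (inj₂ (f≗f′ , uv)) = trans
    (cong₂ _xor_ (¬-not (properG u v uv ∘ sym)) (sym (parity-cong (cong cH ∘ f≗f′))))
    (sym (not-distribˡ-xor (cG u) _))

proposition2p6 : ∀ {m n} (G : FinGraph (suc m)) (H : FinGraph (suc n)) →
    IsBipartite (WreathAdj G H) ⇔ (BipartiteGraph G × BipartiteGraph H)
proposition2p6 G H = mk⇔
  (λ bip → isBipartite-pullback (f₀ ,_) (wreath-base G H f₀) bip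
         , isBipartite-pullback (λ x → updateAt f₀ zero (const x) , zero) (wreath-fibre G H f₀ zero) bip)
  (λ ((cG , properG) , (cH , properH)) →
     isBipartite-fromNot (wreathColouring G H cG cH) (wreathColouring-flips G H properG properH))
  where
  f₀ : Fin _ → Fin _
  f₀ = const zero
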